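{- Let $N$ be a semi-binary network on $n$ leaves with reticulation number $r$, and let $P$ be a cherry decomposition of the bulged version $B(N)$. Then $P$ contains exactly $n-1$ cherry shapes and exactly $r$ reticulated cherry shapes.
   Context: A (phylogenetic) network $N$ on a finite set $X$ is a directed acyclic graph with a unique vertex of indegree $0$ and outdegree $1$ (the root), vertices of indegree $1$ and outdegree $0$ (the leaves) bijectively labelled by $X$, and in which every other vertex has either indegree $1$ (a tree vertex) or outdegree $1$ (a reticulation), but not both. The edge leaving the root is the root edge. A reticulation edge is an edge whose head is a reticulation; the reticulation number is the number of reticulation edges minus the number of reticulations. $N$ is semi-binary if every tree vertex has total degree at most $3$. The bulged version $B(N)$ is the multigraph obtained from $N$ by replacing the outgoing edge of each reticulation of indegree $k$ by $k-1$ parallel edges; in $B(N)$ a reticulation is a vertex of indegree at least $2$ and outdegree at least $1$. A cherry shape is a subgraph of $B(N)$ on three distinct vertices $x,y,p$ with edges $px$ and $py$. A reticulated cherry shape is a subgraph of $B(N)$ on four vertices $x,y,p_x,p_y$ with edges $p_xx$, $p_yp_x$, $p_yy$, where $p_x$ is a reticulation. A cherry decomposition of $B(N)$ is a set $P$ of cherry shapes and reticulated cherry shapes such that every edge of $B(N)$ other than the root edge belongs to exactly one shape in $P$. -}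

module Defs where

open import Data.Nat using (ℕ; zero; suc; _+_; _∸_; _≤_; _≤?_)
open import Data.Nat.Properties using () renaming (_≟_ to _≟ℕ_)
open import Data.Fin using (Fin; _≟_)
open import Data.List using (List; allFin; map; concatMap; filter; length)
open import Data.Product using (Σ; Σ-syntax; ∃; ∃-syntax; _×_; _,_; proj₁; proj₂)
open import Data.Sum using (_⊎_)
open import Data.Bool using (Bool; true; false; if_then_else_)
open import Relation.Nullary using (¬_; Dec; yes; no)
open import Relation.Nullary.Decidable using (⌊_⌋; _×-dec_)
open import Relation.Binary.PropositionalEquality using (_≡_; _≢_)

-- A finite directed graph (possibly with parallel edges a priori):
-- vertices Fin V, edges Fin E, each edge with a tail and a head.
record DiGraph : Set where
  field
    V E : ℕ
    tl hd : Fin E → Fin V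
open DiGraph public

count : {A : Set} {P : A → Set} → ((a : A) → Dec (P a)) → List A → ℕ
count P? xs = length (filter P? xs)

module _ (G : DiGraph) where

  indeg : Fin (V G) → ℕ
  indeg v = count (λ e → hd G e ≟ v) (allFin (E G))

  outdeg : Fin (V G) → ℕ
  outdeg v = count (λ e → tl G e ≟ v) (allFin (E G))

  -- directed walks of length ≥ 1
  data Path : Fin (V G) → Fin (V G) → Set where
    edge : (e : Fin (E G)) → Path (tl G e) (hd G e)
    step : (e : Fin (E G)) {w : Fin (V G)} → Path (hd G e) w → Path (tl G e) w

  Acyclic : Set
  Acyclic = ∀ v → ¬ Path v v

  -- no parallel edges (N is a directed graph, not a multigraph)
  Simple : Set
  Simple = ∀ e e' → tl G e ≡ tl G e' → hd G e ≡ hd G e' → e ≡ e'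

  IsLeaf : Fin (V G) → Set
  IsLeaf v = indeg v ≡ 1 × outdeg v ≡ 0

-- Phylogenetic network on a leaf set X with |X| = n (X identified with Fin n).
record IsNetwork (n : ℕ) (G : DiGraph) : Set where
  field
    acyclic : Acyclic G
    simple  : Simple G
    root    : Fin (V G)
    root-indeg  : indeg G root ≡ 0
    root-outdeg : outdeg G root ≡ 1
    root-unique : ∀ v → indeg G v ≡ 0 → v ≡ root
    label        : Fin n → Fin (V G)
    label-inj    : ∀ i j → label i ≡ label j → i ≡ j
    label-leaf   : ∀ i → IsLeaf G (label i)
    label-onto   : ∀ v → IsLeaf G v → ∃[ i ] label i ≡ v
    -- every other vertex is a tree vertex or a reticulation, not both
    other : ∀ v → v ≢ root → ¬ IsLeaf G v →
            (indeg G v ≡ 1 × outdeg G v ≢ 1) ⊎ (outdeg G v ≡ 1 × indeg G v ≢ 1)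
open IsNetwork public

module _ {n : ℕ} {G : DiGraph} (N : IsNetwork n G) where

  IsTreeVertex : Fin (V G) → Set
  IsTreeVertex v = v ≢ root N × ¬ IsLeaf G v × indeg G v ≡ 1

  SemiBinary : Set
  SemiBinary = ∀ v → IsTreeVertex v → indeg G v + outdeg G v ≤ 3

-- Reticulations of N: the "other" vertices of outdegree 1 (these have indegree ≥ 2;
-- the root has indegree 0 and leaves/tree vertices have indegree 1).
module _ (G : DiGraph) where

  IsRet : Fin (V G) → Set
  IsRet v = 2 ≤ indeg G v × outdeg G v ≡ 1

  isRet? : ∀ v → Dec (IsRet v)
  isRet? v = (2 ≤? indeg G v) ×-dec (outdeg G v ≟ℕ 1)

  retNumber : ℕ
  retNumber = count (λ e → isRet? (hd G e)) (allFin (E G))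
            ∸ count isRet? (allFin (V G))

  -- Bulged version B(N): same vertices; the out-edge e of a reticulation of
  -- indegree k is replaced by k−1 parallel copies (e , 0) … (e , k−2);
  -- every other edge e is kept once as (e , 0).
  mult : Fin (E G) → ℕ
  mult e = if ⌊ isRet? (tl G e) ⌋ then indeg G (tl G e) ∸ 1 else 1

  BEdge : Set
  BEdge = Σ[ e ∈ Fin (E G) ] Fin (mult e)

  btl bhd : BEdge → Fin (V G)
  btl b = tl G (proj₁ b)
  bhd b = hd G (proj₁ b)

  bedges : List BEdge
  bedges = concatMap (λ e → map (e ,_) (allFin (mult e))) (allFin (E G))

  bindeg boutdeg : Fin (V G) → ℕ
  bindeg v = count (λ b → bhd b ≟ v) bedges
  boutdeg v = count (λ b → btl b ≟ v) bedges

  IsBRet : Fin (V G) → Set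
  IsBRet v = 2 ≤ bindeg v × 1 ≤ boutdeg v

  data Shape : Set where
    -- cherry shape: edges p→x (e₁) and p→y (e₂)
    cherry    : (e₁ e₂ : BEdge) → Shape
    -- reticulated cherry shape: edges p_x→x (a), p_y→p_x (b), p_y→y (c)
    retCherry : (a b c : BEdge) → Shape

  IsCherryShape : BEdge → BEdge → Set
  IsCherryShape e₁ e₂ =
    btl e₁ ≡ btl e₂ ×
    bhd e₁ ≢ bhd e₂ × btl e₁ ≢ bhd e₁ × btl e₁ ≢ bhd e₂

  IsRetCherryShape : BEdge → BEdge → BEdge → Set
  IsRetCherryShape a b c =
    bhd b ≡ btl a ×
    btl b ≡ btl c ×
    bhd a ≢ bhd c × bhd a ≢ btl a × bhd a ≢ btl c ×
    bhd c ≢ btl a × bhd c ≢ btl c × btl a ≢ btl c ×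
    IsBRet (btl a)

  ValidShape : Shape → Set
  ValidShape (cherry e₁ e₂)    = IsCherryShape e₁ e₂
  ValidShape (retCherry a b c) = IsRetCherryShape a b c

  _∈S_ : BEdge → Shape → Set
  f ∈S cherry e₁ e₂    = f ≡ e₁ ⊎ f ≡ e₂
  f ∈S retCherry a b c = f ≡ a ⊎ f ≡ b ⊎ f ≡ c

  isCherry isRetCherry : Shape → Bool
  isCherry (cherry _ _)        = true
  isCherry (retCherry _ _ _)   = false
  isRetCherry (cherry _ _)     = false
  isRetCherry (retCherry _ _ _) = true

  IsCherryDecomposition : (root : Fin (V G)) (k : ℕ) → (Fin k → Shape) → Set
  IsCherryDecomposition root k P =
    (∀ i → ValidShape (P i)) ×
    (∀ (f : BEdge) → btl f ≢ root →
       ∃[ i ] (f ∈S P i × (∀ j → f ∈S P j → j ≡ i)))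

  countShapes : (Shape → Bool) → (k : ℕ) → (Fin k → Shape) → ℕ
  countShapes t k P = count (λ i → t (P i) Data.Bool.≟ true) (allFin k)

module Submission where

-- The proof is a double count.  Let c and q be the numbers of cherry and
-- reticulated cherry shapes in P.  Every edge of B(N) other than the root edge
-- lies in exactly one shape; a cherry shape has 2 edges, a reticulated cherry
-- shape 3, and exactly one of the latter (p_x → x) leaves a reticulation.  Hence
--   #(non-root edges of B(N)) = 2c + 3q,   #(edges of B(N) leaving reticulations) = q.
-- Counting the same edges vertex by vertex (root; leaf; tree vertex with degrees
-- (1,2); reticulation with degrees (d,1) and d − 1 bulged out-edges), summing the
-- local balance identities and cancelling the degree sums by the handshake lemma
-- gives 2c + 3q + 2 = 2n + 3q and q + #reticulations = #reticulation edges.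

open import Data.Nat using (ℕ; zero; suc; _+_; _*_; _∸_; _≤_; z≤n; s≤s)
open import Data.Nat.Properties
  using (+-*-semiring; +-identityʳ; *-identityʳ; *-identityˡ; *-zeroʳ; *-comm; *-assoc; *-distribˡ-+;
         m≤m+n; m≤n+m; ≤-trans; ≤-reflexive; +-monoʳ-≤; +-comm; +-assoc; 1+n≰n; 0≢1+n;
         +-cancelʳ-≡; *-cancelˡ-≡; m+n∸n≡m)
  renaming (_≟_ to _≟ℕ_)
open import Data.Fin using (Fin; zero; suc; _≟_)
open import Data.Fin.Properties using (suc-injective)
open import Data.List using (List; []; _∷_; _++_; tabulate; concat; concatMap; map; allFin)
open import Data.List.Properties using (map-tabulate)
open import Data.Nat.ListAction using () renaming (sum to listSum)
open import Data.Product using (Σ; _,_; proj₁; proj₂; _×_)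
open import Data.Sum using (inj₁; inj₂)
open import Relation.Nullary using (¬_; Dec; yes; no; ¬?)
open import Relation.Nullary.Decidable using (⌊_⌋; _×-dec_)
open import Data.Bool using (true; if_then_else_)
open import Data.Bool.Properties using () renaming (_≟_ to _≟𝔹_)
open import Relation.Binary.PropositionalEquality
open import Data.Empty using (⊥-elim)
open import Data.Nat.Tactic.RingSolver using (solve-∀)
open import Function using (_∘_; id)
open import Data.Product.Properties using (≡-dec; ,-injectiveʳ-UIP)
open import Axiom.UniquenessOfIdentityProofs using (module Decidable⇒UIP)
open import Algebra.Properties.Semiring.Sum +-*-semiring
  using (sum; sum-syntax; ∑-distrib-+; ∑-comm; *-distribˡ-sum; sum-cong-≗; sum-replicate-zero)
open import Defs

𝟙 : {A : Set} → Dec A → ℕ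
𝟙 (yes _) = 1
𝟙 (no _)  = 0

𝟙-yes : {A : Set} (d : Dec A) → A → 𝟙 d ≡ 1
𝟙-yes (yes _) _  = refl
𝟙-yes (no ¬a) a = ⊥-elim (¬a a)

𝟙-no : {A : Set} (d : Dec A) → ¬ A → 𝟙 d ≡ 0
𝟙-no (yes a) ¬a = ⊥-elim (¬a a)
𝟙-no (no _)  _  = refl

sum-zero : ∀ {m} (f : Fin m → ℕ) → (∀ i → f i ≡ 0) → sum f ≡ 0
sum-zero {m} f f≡0 = trans (sum-cong-≗ f≡0) (sum-replicate-zero m)

sum-single : ∀ {m} (f : Fin m → ℕ) (i₀ : Fin m) → (∀ i → i ≢ i₀ → f i ≡ 0) → sum f ≡ f i₀
sum-single {suc m} f zero others =
  trans (cong (f zero +_) (sum-zero (f ∘ suc) (λ i → others (suc i) λ ())))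
        (+-identityʳ (f zero))
sum-single {suc m} f (suc i₀) others
  rewrite others zero (λ ()) = sum-single (f ∘ suc) i₀ (λ i i≢i₀ → others (suc i) (i≢i₀ ∘ suc-injective))

sum-const : ∀ m c → ∑[ i < m ] c ≡ m * c
sum-const zero    c = refl
sum-const (suc m) c = cong (c +_) (sum-const m c)

sum-*ˡ : ∀ {m} c (f : Fin m → ℕ) → ∑[ i < m ] (c * f i) ≡ c * sum f
sum-*ˡ c f = sym (*-distribˡ-sum c f)

term≤sum : ∀ {m} (f : Fin m → ℕ) i → f i ≤ sum f
term≤sum f zero    = m≤m+n _ _
term≤sum f (suc i) = ≤-trans (term≤sum (f ∘ suc) i) (m≤n+m _ _)

two-terms≤sum : ∀ {m} (f : Fin m → ℕ) i j → i ≢ j → f i + f j ≤ sum f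
two-terms≤sum f zero    zero    i≢j = ⊥-elim (i≢j refl)
two-terms≤sum f zero    (suc j) _   = +-monoʳ-≤ (f zero) (term≤sum (f ∘ suc) j)
two-terms≤sum f (suc i) zero    _   =
  subst (_≤ sum f) (+-comm (f zero) _) (+-monoʳ-≤ (f zero) (term≤sum (f ∘ suc) i))
two-terms≤sum f (suc i) (suc j) i≢j =
  ≤-trans (two-terms≤sum (f ∘ suc) i j (i≢j ∘ cong suc)) (m≤n+m _ _)

sum-combination : ∀ {m} (f g h : Fin m → ℕ) x y →
                  ∑[ i < m ] (f i + x * g i + y * h i) ≡ sum f + x * sum g + y * sum h
sum-combination f g h x y = begin
  ∑[ i < _ ] (f i + x * g i + y * h i)              ≡⟨ ∑-distrib-+ (λ i → f i + x * g i) (λ i → y * h i) ⟩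
  ∑[ i < _ ] (f i + x * g i) + ∑[ i < _ ] (y * h i)  ≡⟨ cong₂ _+_ (∑-distrib-+ f (λ i → x * g i)) (sum-*ˡ y h) ⟩
  sum f + ∑[ i < _ ] (x * g i) + y * sum h           ≡⟨ cong (λ s → sum f + s + y * sum h) (sum-*ˡ x g) ⟩
  sum f + x * sum g + y * sum h                      ∎
  where open ≡-Reasoning

sum-delta : ∀ {n} (a : Fin n) (F : Fin n → ℕ) → ∑[ v < n ] (𝟙 (a ≟ v) * F v) ≡ F a
sum-delta a F =
  trans (sum-single _ a (λ v v≢a → cong (_* F v) (𝟙-no (a ≟ v) (v≢a ∘ sym))))
        (trans (cong (_* F a) (𝟙-yes (a ≟ a) refl)) (+-identityʳ (F a)))

fibre : ∀ {m n} → (Fin m → Fin n) → Fin n → ℕ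
fibre {m} g v = ∑[ i < m ] 𝟙 (g i ≟ v)

sum-by-fibres : ∀ {m n} (g : Fin m → Fin n) (F : Fin n → ℕ) →
                ∑[ i < m ] F (g i) ≡ ∑[ v < n ] (F v * fibre g v)
sum-by-fibres {m} {n} g F = begin
  ∑[ i < m ] F (g i)                          ≡⟨ sum-cong-≗ (λ i → sym (sum-delta (g i) F)) ⟩
  ∑[ i < m ] ∑[ v < n ] (𝟙 (g i ≟ v) * F v)   ≡⟨ ∑-comm (λ i v → 𝟙 (g i ≟ v) * F v) ⟩
  ∑[ v < n ] ∑[ i < m ] (𝟙 (g i ≟ v) * F v)   ≡⟨ sum-cong-≗ (λ v → sum-cong-≗ (λ i → *-comm (𝟙 (g i ≟ v)) (F v))) ⟩
  ∑[ v < n ] ∑[ i < m ] (F v * 𝟙 (g i ≟ v))   ≡⟨ sum-cong-≗ (λ v → sum-*ˡ {m} (F v) (λ i → 𝟙 (g i ≟ v))) ⟩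
  ∑[ v < n ] (F v * fibre g v)                ∎
  where open ≡-Reasoning

sum-fibres : ∀ {m n} (g : Fin m → Fin n) → ∑[ v < n ] fibre g v ≡ m
sum-fibres {m} {n} g = sym (begin
  m                                 ≡⟨ sym (trans (sum-const m 1) (*-identityʳ m)) ⟩
  ∑[ i < m ] 1                      ≡⟨ sum-by-fibres g (λ _ → 1) ⟩
  ∑[ v < n ] (1 * fibre g v)        ≡⟨ sum-cong-≗ (λ v → +-identityʳ (fibre g v)) ⟩
  ∑[ v < n ] fibre g v              ∎)
  where open ≡-Reasoning

fibre-nonempty : ∀ {m n} (g : Fin m → Fin n) {v i} → g i ≡ v → 1 ≤ fibre g v
fibre-nonempty g {v} {i} gi≡v =
  subst (_≤ fibre g v) (𝟙-yes (g i ≟ v) gi≡v) (term≤sum (λ i → 𝟙 (g i ≟ v)) i)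

fibre-unique : ∀ {m n} (g : Fin m → Fin n) {v} → fibre g v ≡ 1 →
               ∀ {i j} → g i ≡ v → g j ≡ v → i ≡ j
fibre-unique g {v} size≡1 {i} {j} gi≡v gj≡v with i ≟ j
... | yes i≡j = i≡j
... | no i≢j  = ⊥-elim (1+n≰n (subst (2 ≤_) size≡1 two≤size))
  where
  two≤size : 2 ≤ fibre g v
  two≤size = subst (_≤ fibre g v) (cong₂ _+_ (𝟙-yes (g i ≟ v) gi≡v) (𝟙-yes (g j ≟ v) gj≡v))
                   (two-terms≤sum (λ i → 𝟙 (g i ≟ v)) i j i≢j)

count-∷ : ∀ {A : Set} {P : A → Set} (P? : ∀ a → Dec (P a)) x xs →
          count P? (x ∷ xs) ≡ 𝟙 (P? x) + count P? xs
count-∷ P? x xs with P? x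
... | yes _ = refl
... | no _  = refl

count-++ : ∀ {A : Set} {P : A → Set} (P? : ∀ a → Dec (P a)) xs ys →
           count P? (xs ++ ys) ≡ count P? xs + count P? ys
count-++ P? []       ys = refl
count-++ P? (x ∷ xs) ys = begin
  count P? (x ∷ xs ++ ys)               ≡⟨ count-∷ P? x (xs ++ ys) ⟩
  𝟙 (P? x) + count P? (xs ++ ys)        ≡⟨ cong (𝟙 (P? x) +_) (count-++ P? xs ys) ⟩
  𝟙 (P? x) + (count P? xs + count P? ys) ≡⟨ sym (+-assoc (𝟙 (P? x)) _ _) ⟩
  𝟙 (P? x) + count P? xs + count P? ys  ≡⟨ cong (_+ count P? ys) (sym (count-∷ P? x xs)) ⟩
  count P? (x ∷ xs) + count P? ys       ∎
  where open ≡-Reasoning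

count-tabulate : ∀ {A : Set} {P : A → Set} (P? : ∀ a → Dec (P a)) {m} (f : Fin m → A) →
                 count P? (tabulate f) ≡ ∑[ i < m ] 𝟙 (P? (f i))
count-tabulate P? {zero}  f = refl
count-tabulate P? {suc m} f =
  trans (count-∷ P? (f zero) _) (cong (𝟙 (P? (f zero)) +_) (count-tabulate P? (f ∘ suc)))

count-concat-tabulate : ∀ {A : Set} {P : A → Set} (P? : ∀ a → Dec (P a)) {m} (xs : Fin m → List A) →
                        count P? (concat (tabulate xs)) ≡ ∑[ i < m ] count P? (xs i)
count-concat-tabulate P? {zero}  xs = refl
count-concat-tabulate P? {suc m} xs =
  trans (count-++ P? (xs zero) _) (cong (count P? (xs zero) +_) (count-concat-tabulate P? (xs ∘ suc)))

-- Sums over a finite dependent sum  Σ (i : Fin m) (Fin (c i)),  enumerated as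
-- in Defs (the edges of a bulged network are such a set).
module DependentSum {m : ℕ} (c : Fin m → ℕ) where

  Point : Set
  Point = Σ (Fin m) (λ i → Fin (c i))

  points : List Point
  points = concatMap (λ i → map (i ,_) (allFin (c i))) (allFin m)

  ∑Σ : (Point → ℕ) → ℕ
  ∑Σ w = ∑[ i < m ] ∑[ j < c i ] w (i , j)

  _≟Σ_ : (p q : Point) → Dec (p ≡ q)
  _≟Σ_ = ≡-dec _≟_ _≟_

  count-points : ∀ {P : Point → Set} (P? : ∀ p → Dec (P p)) → count P? points ≡ ∑Σ (λ p → 𝟙 (P? p))
  count-points P? = begin
    count P? (concat (map row (tabulate id)))   ≡⟨ cong (count P? ∘ concat) (map-tabulate id row) ⟩
    count P? (concat (tabulate row))            ≡⟨ count-concat-tabulate P? row ⟩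
    ∑[ i < m ] count P? (row i)                 ≡⟨ sum-cong-≗ (λ i → cong (count P?) (map-tabulate id (i ,_))) ⟩
    ∑[ i < m ] count P? (tabulate (i ,_))       ≡⟨ sum-cong-≗ (λ i → count-tabulate P? (i ,_)) ⟩
    ∑Σ (λ p → 𝟙 (P? p))                         ∎
    where
    open ≡-Reasoning
    row : Fin m → List Point
    row i = map (i ,_) (allFin (c i))

  ∑Σ-cong : ∀ {w w′ : Point → ℕ} → (∀ p → w p ≡ w′ p) → ∑Σ w ≡ ∑Σ w′
  ∑Σ-cong w≗w′ = sum-cong-≗ (λ i → sum-cong-≗ (λ j → w≗w′ (i , j)))

  ∑Σ-zero : ∑Σ (λ _ → 0) ≡ 0
  ∑Σ-zero = sum-zero {m} _ (λ i → sum-zero {c i} _ (λ _ → refl))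

  ∑Σ-+ : ∀ (w w′ : Point → ℕ) → ∑Σ (λ p → w p + w′ p) ≡ ∑Σ w + ∑Σ w′
  ∑Σ-+ w w′ = trans (sum-cong-≗ (λ i → ∑-distrib-+ (λ j → w (i , j)) (λ j → w′ (i , j))))
                    (∑-distrib-+ (λ i → ∑[ j < c i ] w (i , j)) (λ i → ∑[ j < c i ] w′ (i , j)))

  ∑Σ-comm : ∀ {k} (w : Point → Fin k → ℕ) → ∑Σ (λ p → ∑[ t < k ] w p t) ≡ ∑[ t < k ] ∑Σ (λ p → w p t)
  ∑Σ-comm w = trans (sum-cong-≗ (λ i → ∑-comm (λ j t → w (i , j) t)))
                    (∑-comm (λ i t → ∑[ j < c i ] w (i , j) t))

  ∑Σ-proj₁ : ∀ (F : Fin m → ℕ) → ∑Σ (λ p → F (proj₁ p)) ≡ ∑[ i < m ] (c i * F i)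
  ∑Σ-proj₁ F = sum-cong-≗ (λ i → sum-const (c i) (F i))

  ∑Σ-single : ∀ (w : Point → ℕ) q → (∀ p → p ≢ q → w p ≡ 0) → ∑Σ w ≡ w q
  ∑Σ-single w (i₀ , j₀) others =
    trans (sum-single _ i₀ (λ i i≢i₀ → sum-zero _ (λ j → others (i , j) (i≢i₀ ∘ cong proj₁))))
          (sum-single _ j₀ (λ j j≢j₀ → others (i₀ , j) (j≢j₀ ∘ ,-injectiveʳ-UIP (Decidable⇒UIP.≡-irrelevant _≟_))))

  δ : Point → Point → ℕ
  δ p q = 𝟙 (p ≟Σ q)

  δ-self : ∀ p → δ p p ≡ 1
  δ-self p = 𝟙-yes (p ≟Σ p) refl

  δ-distinct : ∀ {p q} → p ≢ q → δ p q ≡ 0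
  δ-distinct {p} {q} = 𝟙-no (p ≟Σ q)

  ∑Σ-occurrences : ∀ (w : Point → ℕ) (xs : List Point) →
                   ∑Σ (λ p → w p * listSum (map (δ p) xs)) ≡ listSum (map w xs)
  ∑Σ-occurrences w []       = trans (∑Σ-cong (λ p → *-zeroʳ (w p))) ∑Σ-zero
  ∑Σ-occurrences w (x ∷ xs) = begin
    ∑Σ (λ p → w p * (δ p x + listSum (map (δ p) xs)))          ≡⟨ ∑Σ-cong (λ p → *-distribˡ-+ (w p) (δ p x) _) ⟩
    ∑Σ (λ p → w p * δ p x + w p * listSum (map (δ p) xs))      ≡⟨ ∑Σ-+ _ _ ⟩
    ∑Σ (λ p → w p * δ p x) + ∑Σ (λ p → w p * listSum (map (δ p) xs))
                                                                ≡⟨ cong₂ _+_ ∑Σ-delta (∑Σ-occurrences w xs) ⟩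
    w x + listSum (map w xs)                                    ∎
    where
    open ≡-Reasoning
    ∑Σ-delta : ∑Σ (λ p → w p * δ p x) ≡ w x
    ∑Σ-delta = trans (∑Σ-single _ x (λ p p≢x → trans (cong (w p *_) (δ-distinct p≢x)) (*-zeroʳ (w p))))
                     (trans (cong (w x *_) (δ-self x)) (*-identityʳ (w x)))

module Degrees (G : DiGraph) where

  open DependentSum (mult G) public
    using (∑Σ; ∑Σ-cong; ∑Σ-comm; ∑Σ-single; ∑Σ-occurrences; δ; δ-self; δ-distinct)

  indeg-fibre : ∀ v → indeg G v ≡ fibre (hd G) v
  indeg-fibre v = count-tabulate (λ e → hd G e ≟ v) id

  outdeg-fibre : ∀ v → outdeg G v ≡ fibre (tl G) v
  outdeg-fibre v = count-tabulate (λ e → tl G e ≟ v) id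

  -- Both degree sums count the edges.
  handshake : ∑[ v < V G ] indeg G v ≡ ∑[ v < V G ] outdeg G v
  handshake = begin
    ∑[ v < V G ] indeg G v       ≡⟨ sum-cong-≗ indeg-fibre ⟩
    ∑[ v < V G ] fibre (hd G) v  ≡⟨ sum-fibres (hd G) ⟩
    E G                          ≡⟨ sum-fibres (tl G) ⟨
    ∑[ v < V G ] fibre (tl G) v  ≡⟨ sum-cong-≗ outdeg-fibre ⟨
    ∑[ v < V G ] outdeg G v      ∎
    where open ≡-Reasoning

  copies : Fin (V G) → ℕ
  copies v = if ⌊ isRet? G v ⌋ then indeg G v ∸ 1 else 1

  bulgedOut : Fin (V G) → ℕ
  bulgedOut v = copies v * outdeg G v

  ∑-by-tails : ∀ (F : Fin (V G) → ℕ) → ∑Σ (λ f → F (btl G f)) ≡ ∑[ v < V G ] (F v * bulgedOut v)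
  ∑-by-tails F = begin
    ∑Σ (λ f → F (btl G f))                            ≡⟨ DependentSum.∑Σ-proj₁ (mult G) (F ∘ tl G) ⟩
    ∑[ e < E G ] (copies (tl G e) * F (tl G e))       ≡⟨ sum-by-fibres (tl G) (λ v → copies v * F v) ⟩
    ∑[ v < V G ] (copies v * F v * fibre (tl G) v)    ≡⟨ sum-cong-≗ rearrange ⟩
    ∑[ v < V G ] (F v * bulgedOut v)                  ∎
    where
    open ≡-Reasoning
    rearrange : ∀ v → copies v * F v * fibre (tl G) v ≡ F v * bulgedOut v
    rearrange v = begin
      copies v * F v * fibre (tl G) v    ≡⟨ cong (λ x → x * fibre (tl G) v) (*-comm (copies v) (F v)) ⟩
      F v * copies v * fibre (tl G) v    ≡⟨ *-assoc (F v) (copies v) _ ⟩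
      F v * (copies v * fibre (tl G) v)  ≡⟨ cong (λ x → F v * (copies v * x)) (outdeg-fibre v) ⟨
      F v * bulgedOut v                  ∎

  bindeg-copies : ∀ v → bindeg G v ≡ ∑[ e < E G ] (mult G e * 𝟙 (hd G e ≟ v))
  bindeg-copies v = trans (DependentSum.count-points (mult G) (λ f → bhd G f ≟ v))
                          (DependentSum.∑Σ-proj₁ (mult G) (λ e → 𝟙 (hd G e ≟ v)))


  branching : ∀ (f g : BEdge G) → btl G f ≡ btl G g → bhd G f ≢ bhd G g → outdeg G (btl G f) ≢ 1
  branching f g same-tail distinct-heads out≡1 = distinct-heads (cong (hd G) same-edge)
    where
    same-edge : proj₁ f ≡ proj₁ g
    same-edge = fibre-unique (tl G) (trans (sym (outdeg-fibre (btl G f))) out≡1) refl (sym same-tail)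

  has-in-edge : ∀ {v e} → hd G e ≡ v → 1 ≤ indeg G v
  has-in-edge {v} e→v = subst (1 ≤_) (sym (indeg-fibre v)) (fibre-nonempty (hd G) e→v)

  has-out-edge : ∀ {v e} → tl G e ≡ v → 1 ≤ outdeg G v
  has-out-edge {v} v→e = subst (1 ≤_) (sym (outdeg-fibre v)) (fibre-nonempty (tl G) v→e)

  copies-nonRet : ∀ {v} → ¬ IsRet G v → copies v ≡ 1
  copies-nonRet {v} ¬ret with isRet? G v
  ... | yes ret = ⊥-elim (¬ret ret)
  ... | no _    = refl

  bindeg-single : ∀ {v e} → indeg G v ≡ 1 → hd G e ≡ v → bindeg G v ≡ copies (tl G e)
  bindeg-single {v} {e} in≡1 e→v = begin
    bindeg G v                                   ≡⟨ bindeg-copies v ⟩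
    ∑[ e′ < E G ] (mult G e′ * 𝟙 (hd G e′ ≟ v))  ≡⟨ sum-single _ e other-in-edges ⟩
    mult G e * 𝟙 (hd G e ≟ v)                    ≡⟨ cong (mult G e *_) (𝟙-yes (hd G e ≟ v) e→v) ⟩
    mult G e * 1                                 ≡⟨ *-identityʳ (mult G e) ⟩
    copies (tl G e)                              ∎
    where
    open ≡-Reasoning
    other-in-edges : ∀ e′ → e′ ≢ e → mult G e′ * 𝟙 (hd G e′ ≟ v) ≡ 0
    other-in-edges e′ e′≢e = trans (cong (mult G e′ *_) (𝟙-no (hd G e′ ≟ v) (λ e′→v → e′≢e
      (fibre-unique (hd G) (trans (sym (indeg-fibre v)) in≡1) e′→v e→v)))) (*-zeroʳ (mult G e′))

module Network {n : ℕ} {G : DiGraph} (N : IsNetwork n G) (semiBinary : SemiBinary N) where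

  open Degrees G

  leaf? : ∀ v → Dec (IsLeaf G v)
  leaf? v = (indeg G v ≟ℕ 1) ×-dec (outdeg G v ≟ℕ 0)

  rootᵢ nonRootᵢ leafᵢ retᵢ : Fin (V G) → ℕ
  rootᵢ v    = 𝟙 (v ≟ root N)
  nonRootᵢ v = 𝟙 (¬? (v ≟ root N))
  leafᵢ v    = 𝟙 (leaf? v)
  retᵢ v     = 𝟙 (isRet? G v)

  data Kind (v : Fin (V G)) : Set where
    rootKind : v ≡ root N → Kind v
    leafKind : v ≢ root N → IsLeaf G v → Kind v
    treeKind : v ≢ root N → indeg G v ≡ 1 → outdeg G v ≡ 2 → Kind v
    retKind  : v ≢ root N → ∀ j → indeg G v ≡ 2 + j → outdeg G v ≡ 1 → Kind v

  isRet-of : ∀ {v} j → indeg G v ≡ 2 + j → outdeg G v ≡ 1 → IsRet G v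
  isRet-of j in≡2+j out≡1 = subst (2 ≤_) (sym in≡2+j) (s≤s (s≤s z≤n)) , out≡1

  tree-outdeg : ∀ {v} → v ≢ root N → ¬ IsLeaf G v → indeg G v ≡ 1 → outdeg G v ≢ 1 → outdeg G v ≡ 2
  tree-outdeg {v} v≢r ¬leaf in≡1 out≢1 = at-most-two (outdeg G v) degree-bound (λ out≡0 → ¬leaf (in≡1 , out≡0)) out≢1
    where
    degree-bound : 1 + outdeg G v ≤ 3
    degree-bound = subst (λ i → i + outdeg G v ≤ 3) in≡1 (semiBinary v (v≢r , ¬leaf , in≡1))
    at-most-two : ∀ o → 1 + o ≤ 3 → o ≢ 0 → o ≢ 1 → o ≡ 2
    at-most-two 0 _ o≢0 _ = ⊥-elim (o≢0 refl)
    at-most-two 1 _ _ o≢1 = ⊥-elim (o≢1 refl)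
    at-most-two 2 _ _ _   = refl
    at-most-two (suc (suc (suc o))) (s≤s (s≤s (s≤s ()))) _ _

  ret-indeg : ∀ {v} → v ≢ root N → indeg G v ≢ 1 → Σ ℕ (λ j → indeg G v ≡ 2 + j)
  ret-indeg {v} v≢r in≢1 with indeg G v | root-unique N v
  ... | 0           | unique = ⊥-elim (v≢r (unique refl))
  ... | 1           | _      = ⊥-elim (in≢1 refl)
  ... | suc (suc j) | _      = j , refl

  kind : ∀ v → Kind v
  kind v with v ≟ root N
  ... | yes v≡r = rootKind v≡r
  ... | no v≢r with leaf? v
  ...   | yes leaf = leafKind v≢r leaf
  ...   | no ¬leaf with other N v v≢r ¬leaf
  ...     | inj₁ (in≡1 , out≢1) = treeKind v≢r in≡1 (tree-outdeg v≢r ¬leaf in≡1 out≢1)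
  ...     | inj₂ (out≡1 , in≢1) with ret-indeg v≢r in≢1
  ...       | j , in≡2+j = retKind v≢r j in≡2+j out≡1

  rootᵢ-yes : ∀ {v} → v ≡ root N → rootᵢ v ≡ 1
  rootᵢ-yes {v} = 𝟙-yes (v ≟ root N)

  rootᵢ-no : ∀ {v} → v ≢ root N → rootᵢ v ≡ 0
  rootᵢ-no {v} = 𝟙-no (v ≟ root N)

  nonRootᵢ-yes : ∀ {v} → v ≢ root N → nonRootᵢ v ≡ 1
  nonRootᵢ-yes {v} = 𝟙-yes (¬? (v ≟ root N))

  nonRootᵢ-no : ∀ {v} → v ≡ root N → nonRootᵢ v ≡ 0
  nonRootᵢ-no {v} v≡r = 𝟙-no (¬? (v ≟ root N)) (λ v≢r → v≢r v≡r)

  leafᵢ-yes : ∀ {v} → IsLeaf G v → leafᵢ v ≡ 1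
  leafᵢ-yes {v} = 𝟙-yes (leaf? v)

  leafᵢ-no : ∀ {v} → outdeg G v ≢ 0 → leafᵢ v ≡ 0
  leafᵢ-no {v} out≢0 = 𝟙-no (leaf? v) (out≢0 ∘ proj₂)

  retᵢ-yes : ∀ {v} → IsRet G v → retᵢ v ≡ 1
  retᵢ-yes {v} = 𝟙-yes (isRet? G v)

  retᵢ-no : ∀ {v} → indeg G v ≤ 1 → retᵢ v ≡ 0
  retᵢ-no {v} in≤1 = 𝟙-no (isRet? G v) (λ (two≤in , _) → 1+n≰n (≤-trans two≤in in≤1))

  bulgedOut-tree : ∀ {v} → indeg G v ≤ 1 → bulgedOut v ≡ outdeg G v
  bulgedOut-tree {v} in≤1 with isRet? G v
  ... | yes (two≤in , _) = ⊥-elim (1+n≰n (≤-trans two≤in in≤1))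
  ... | no _             = +-identityʳ (outdeg G v)

  bulgedOut-ret : ∀ {v} j → indeg G v ≡ 2 + j → outdeg G v ≡ 1 → bulgedOut v ≡ 1 + j
  bulgedOut-ret {v} j in≡2+j out≡1 with isRet? G v
  ... | no ¬ret = ⊥-elim (¬ret (isRet-of j in≡2+j out≡1))
  ... | yes _ rewrite in≡2+j | out≡1 = *-identityʳ (1 + j)

  root-indeg≤1 : indeg G (root N) ≤ 1
  root-indeg≤1 = subst (_≤ 1) (sym (root-indeg N)) z≤n

  -- Local balance at a vertex: the root contributes its out-edge, a leaf its
  -- in-edge, a tree vertex 1 in- and 2 out-edges, a reticulation of indegree
  -- 2 + j has 1 + j bulged out-edges.  Summed over all vertices, this relates
  -- the non-root edges of B(N), the reticulate edges of B(N) and the leaves.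
  vertex-balance : ∀ v →
    nonRootᵢ v * bulgedOut v + 2 * indeg G v + 2 * rootᵢ v
      ≡ 2 * leafᵢ v + 3 * (retᵢ v * nonRootᵢ v * bulgedOut v) + 2 * outdeg G v
  vertex-balance v with kind v
  ... | rootKind refl
    rewrite bulgedOut-tree root-indeg≤1 | rootᵢ-yes refl | nonRootᵢ-no refl
          | leafᵢ-no (λ out≡0 → 0≢1+n (trans (sym out≡0) (root-outdeg N)))
          | retᵢ-no root-indeg≤1 | root-indeg N | root-outdeg N = refl
  ... | leafKind v≢r (in≡1 , out≡0)
    rewrite bulgedOut-tree (≤-reflexive in≡1) | rootᵢ-no v≢r | nonRootᵢ-yes v≢r
          | leafᵢ-yes (in≡1 , out≡0) | retᵢ-no (≤-reflexive in≡1) | in≡1 | out≡0 = refl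
  ... | treeKind v≢r in≡1 out≡2
    rewrite bulgedOut-tree (≤-reflexive in≡1) | rootᵢ-no v≢r | nonRootᵢ-yes v≢r
          | leafᵢ-no (λ out≡0 → 0≢1+n (trans (sym out≡0) out≡2))
          | retᵢ-no (≤-reflexive in≡1) | in≡1 | out≡2 = refl
  ... | retKind v≢r j in≡2+j out≡1
    rewrite bulgedOut-ret j in≡2+j out≡1 | rootᵢ-no v≢r | nonRootᵢ-yes v≢r
          | leafᵢ-no (λ out≡0 → 0≢1+n (trans (sym out≡0) out≡1))
          | retᵢ-yes (isRet-of j in≡2+j out≡1) | in≡2+j | out≡1 = reticulation j
    where
    reticulation : ∀ j → 1 * (1 + j) + 2 * (2 + j) + 2 * 0 ≡ 2 * 0 + 3 * (1 * 1 * (1 + j)) + 2 * 1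
    reticulation = solve-∀

  -- A reticulation of indegree d has d − 1 bulged out-edges.
  reticulation-balance : ∀ v → retᵢ v * nonRootᵢ v * bulgedOut v + retᵢ v ≡ retᵢ v * indeg G v
  reticulation-balance v with kind v
  ... | rootKind refl                rewrite retᵢ-no root-indeg≤1 = refl
  ... | leafKind _ (in≡1 , _)        rewrite retᵢ-no (≤-reflexive in≡1) = refl
  ... | treeKind _ in≡1 _            rewrite retᵢ-no (≤-reflexive in≡1) = refl
  ... | retKind v≢r j in≡2+j out≡1
    rewrite bulgedOut-ret j in≡2+j out≡1 | nonRootᵢ-yes v≢r
          | retᵢ-yes (isRet-of j in≡2+j out≡1) | in≡2+j = reticulation j
    where
    reticulation : ∀ j → 1 * 1 * (1 + j) + 1 ≡ 1 * (2 + j)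
    reticulation = solve-∀

  root-count : ∑[ v < V G ] rootᵢ v ≡ 1
  root-count = trans (sum-single rootᵢ (root N) (λ v → rootᵢ-no)) (rootᵢ-yes refl)

  leafᵢ-labels : ∀ v → leafᵢ v ≡ fibre (label N) v
  leafᵢ-labels v with leaf? v
  ... | yes leaf with label-onto N v leaf
  ...   | i₀ , labelled = sym (trans (sum-single _ i₀ other-labels) (𝟙-yes (label N i₀ ≟ v) labelled))
    where
    other-labels : ∀ i → i ≢ i₀ → 𝟙 (label N i ≟ v) ≡ 0
    other-labels i i≢i₀ = 𝟙-no (label N i ≟ v) (λ l≡v → i≢i₀ (label-inj N i i₀ (trans l≡v (sym labelled))))
  leafᵢ-labels v | no ¬leaf =
    sym (sum-zero _ (λ i → 𝟙-no (label N i ≟ v) (λ l≡v → ¬leaf (subst (IsLeaf G) l≡v (label-leaf N i)))))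

  leaf-count : ∑[ v < V G ] leafᵢ v ≡ n
  leaf-count = trans (sum-cong-≗ leafᵢ-labels) (sum-fibres (label N))

  reticulate-edge-count : count (λ e → isRet? G (hd G e)) (allFin (E G)) ≡ ∑[ v < V G ] (retᵢ v * indeg G v)
  reticulate-edge-count = begin
    count (λ e → isRet? G (hd G e)) (allFin (E G))  ≡⟨ count-tabulate (λ e → isRet? G (hd G e)) id ⟩
    ∑[ e < E G ] retᵢ (hd G e)                      ≡⟨ sum-by-fibres (hd G) retᵢ ⟩
    ∑[ v < V G ] (retᵢ v * fibre (hd G) v)          ≡⟨ sum-cong-≗ (λ v → cong (retᵢ v *_) (indeg-fibre v)) ⟨
    ∑[ v < V G ] (retᵢ v * indeg G v)               ∎
    where open ≡-Reasoning

  reticulation-count : count (isRet? G) (allFin (V G)) ≡ ∑[ v < V G ] retᵢ v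
  reticulation-count = count-tabulate (isRet? G) id

module Shapes (G : DiGraph) where

  open Degrees G

  shapeEdges : Shape G → List (BEdge G)
  shapeEdges (cherry e₁ e₂)    = e₁ ∷ e₂ ∷ []
  shapeEdges (retCherry a b c) = a ∷ b ∷ c ∷ []

  occurrences : Shape G → BEdge G → ℕ
  occurrences S f = listSum (map (δ f) (shapeEdges S))

  weight : (BEdge G → ℕ) → Shape G → ℕ
  weight w S = listSum (map w (shapeEdges S))

  ∑-occurrences : ∀ (w : BEdge G → ℕ) S → ∑Σ (λ f → w f * occurrences S f) ≡ weight w S
  ∑-occurrences w S = ∑Σ-occurrences w (shapeEdges S)

  weight-one : ∀ S → weight (λ _ → 1) S ≡ 2 * 𝟙 (isCherry G S ≟𝔹 true) + 3 * 𝟙 (isRetCherry G S ≟𝔹 true)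
  weight-one (cherry _ _)      = refl
  weight-one (retCherry _ _ _) = refl

  occurrences-absent : ∀ S f → ¬ (_∈S_ G f S) → occurrences S f ≡ 0
  occurrences-absent (cherry e₁ e₂) f f∉S =
    cong₂ _+_ (δ-distinct (f∉S ∘ inj₁)) (cong (_+ 0) (δ-distinct (f∉S ∘ inj₂)))
  occurrences-absent (retCherry a b c) f f∉S =
    cong₂ _+_ (δ-distinct (f∉S ∘ inj₁))
              (cong₂ _+_ (δ-distinct (f∉S ∘ inj₂ ∘ inj₁)) (cong (_+ 0) (δ-distinct (f∉S ∘ inj₂ ∘ inj₂))))

  -- The edges of a valid shape are pairwise distinct (their heads differ).
  occurrences-present : ∀ S → ValidShape G S → ∀ f → _∈S_ G f S → occurrences S f ≡ 1
  occurrences-present (cherry e₁ e₂) (_ , x≢y , _) f (inj₁ refl) =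
    cong₂ _+_ (δ-self e₁) (cong (_+ 0) (δ-distinct (x≢y ∘ cong (bhd G))))
  occurrences-present (cherry e₁ e₂) (_ , x≢y , _) f (inj₂ refl) =
    cong₂ _+_ (δ-distinct (x≢y ∘ sym ∘ cong (bhd G))) (cong (_+ 0) (δ-self e₂))
  occurrences-present (retCherry a b c) (b→px , _ , x≢y , x≢px , _ , y≢px , _) f (inj₁ refl) =
    cong₂ _+_ (δ-self a)
      (cong₂ _+_ (δ-distinct (λ a≡b → x≢px (trans (cong (bhd G) a≡b) b→px)))
                 (cong (_+ 0) (δ-distinct (x≢y ∘ cong (bhd G)))))
  occurrences-present (retCherry a b c) (b→px , _ , x≢y , x≢px , _ , y≢px , _) f (inj₂ (inj₁ refl)) =
    cong₂ _+_ (δ-distinct (λ b≡a → x≢px (trans (cong (bhd G) (sym b≡a)) b→px)))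
      (cong₂ _+_ (δ-self b) (cong (_+ 0) (δ-distinct (λ b≡c → y≢px (trans (cong (bhd G) (sym b≡c)) b→px)))))
  occurrences-present (retCherry a b c) (b→px , _ , x≢y , x≢px , _ , y≢px , _) f (inj₂ (inj₂ refl)) =
    cong₂ _+_ (δ-distinct (x≢y ∘ sym ∘ cong (bhd G)))
      (cong₂ _+_ (δ-distinct (λ c≡b → y≢px (trans (cong (bhd G) c≡b) b→px))) (cong (_+ 0) (δ-self c)))

module ShapesInNetwork {n : ℕ} {G : DiGraph} (N : IsNetwork n G) (semiBinary : SemiBinary N) where

  open Degrees G
  open Network N semiBinary
  open Shapes G

  branching-nonRoot : ∀ {v} → outdeg G v ≢ 1 → v ≢ root N
  branching-nonRoot out≢1 refl = out≢1 (root-outdeg N)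

  branching-nonRet : ∀ {v} → outdeg G v ≢ 1 → ¬ IsRet G v
  branching-nonRet out≢1 (_ , out≡1) = out≢1 out≡1

  ret-nonRoot : ∀ {v} → IsRet G v → v ≢ root N
  ret-nonRoot (two≤in , _) refl = 1+n≰n (≤-trans two≤in root-indeg≤1)

  py-branching : ∀ {a b c} → IsRetCherryShape G a b c → outdeg G (btl G b) ≢ 1
  py-branching {a} {b} {c} (b→px , same-tail , _ , _ , _ , y≢px , _) =
    branching b c same-tail (λ px≡y → y≢px (trans (sym px≡y) b→px))

  -- … and p_x is a reticulation of N: it has an in-edge and an out-edge, and
  -- were it a tree vertex its single in-edge (from the non-reticulation p_y)
  -- would not be duplicated, contradicting indegree ≥ 2 in B(N).
  px-reticulation : ∀ {a b c} → IsRetCherryShape G a b c → IsRet G (btl G a)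
  px-reticulation {a} {b} {c} shape@(b→px , _ , _ , _ , _ , _ , _ , _ , (two≤bin , _)) with kind (btl G a)
  ... | rootKind px≡r =
    ⊥-elim (1+n≰n (subst (1 ≤_) (trans (cong (indeg G) px≡r) (root-indeg N)) (has-in-edge b→px)))
  ... | leafKind _ (_ , out≡0) = ⊥-elim (1+n≰n (subst (1 ≤_) out≡0 (has-out-edge {e = proj₁ a} refl)))
  ... | treeKind _ in≡1 _ = ⊥-elim (1+n≰n (subst (2 ≤_) single-copy two≤bin))
    where
    single-copy : bindeg G (btl G a) ≡ 1
    single-copy = trans (bindeg-single in≡1 b→px) (copies-nonRet (branching-nonRet (py-branching {a} {b} {c} shape)))
  ... | retKind _ j in≡2+j out≡1 = isRet-of j in≡2+j out≡1

  branching-retᵢ : ∀ {v} → outdeg G v ≢ 1 → retᵢ v ≡ 0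
  branching-retᵢ {v} out≢1 = 𝟙-no (isRet? G v) (branching-nonRet out≢1)

  shape-tail-nonRoot : ∀ S → ValidShape G S → ∀ f → _∈S_ G f S → btl G f ≢ root N
  shape-tail-nonRoot (cherry e₁ e₂) (same-tail , x≢y , _) f (inj₁ refl) =
    branching-nonRoot (branching e₁ e₂ same-tail x≢y)
  shape-tail-nonRoot (cherry e₁ e₂) (same-tail , x≢y , _) f (inj₂ refl) =
    subst (_≢ root N) same-tail (branching-nonRoot (branching e₁ e₂ same-tail x≢y))
  shape-tail-nonRoot (retCherry a b c) shape f (inj₁ refl) =
    ret-nonRoot (px-reticulation {a} {b} {c} shape)
  shape-tail-nonRoot (retCherry a b c) shape f (inj₂ (inj₁ refl)) =
    branching-nonRoot (py-branching {a} {b} {c} shape)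
  shape-tail-nonRoot (retCherry a b c) shape@(_ , same-tail , _) f (inj₂ (inj₂ refl)) =
    subst (_≢ root N) same-tail (branching-nonRoot (py-branching {a} {b} {c} shape))

  weight-ret : ∀ S → ValidShape G S → weight (retᵢ ∘ btl G) S ≡ 𝟙 (isRetCherry G S ≟𝔹 true)
  weight-ret (cherry e₁ e₂) (same-tail , x≢y , _) =
    cong₂ _+_ (branching-retᵢ p-branching) (cong (_+ 0) (branching-retᵢ (subst (λ p → outdeg G p ≢ 1) same-tail p-branching)))
    where
    p-branching : outdeg G (btl G e₁) ≢ 1
    p-branching = branching e₁ e₂ same-tail x≢y
  weight-ret (retCherry a b c) shape@(_ , same-tail , _) =
    cong₂ _+_ (retᵢ-yes (px-reticulation {a} {b} {c} shape))
      (cong₂ _+_ (branching-retᵢ py-branches) (cong (_+ 0) (branching-retᵢ (subst (λ p → outdeg G p ≢ 1) same-tail py-branches))))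
    where
    py-branches : outdeg G (btl G b) ≢ 1
    py-branches = py-branching {a} {b} {c} shape

cancel-balance : ∀ c q d n → 2 * c + 3 * q + 2 * d + 2 * 1 ≡ 2 * n + 3 * q + 2 * d → c ≡ n ∸ 1
cancel-balance c q d n balance = begin
  c          ≡⟨ m+n∸n≡m c 1 ⟨
  c + 1 ∸ 1  ≡⟨ cong (_∸ 1) (*-cancelˡ-≡ (c + 1) n 2 (+-cancelʳ-≡ (3 * q + 2 * d) _ _ doubled)) ⟩
  n ∸ 1      ∎
  where
  open ≡-Reasoning
  regroupˡ : ∀ c q d → 2 * (c + 1) + (3 * q + 2 * d) ≡ 2 * c + 3 * q + 2 * d + 2 * 1
  regroupˡ = solve-∀
  regroupʳ : ∀ n q d → 2 * n + 3 * q + 2 * d ≡ 2 * n + (3 * q + 2 * d)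
  regroupʳ = solve-∀
  doubled : 2 * (c + 1) + (3 * q + 2 * d) ≡ 2 * n + (3 * q + 2 * d)
  doubled = trans (regroupˡ c q d) (trans balance (regroupʳ n q d))

module Decomposition {n : ℕ} {G : DiGraph} (N : IsNetwork n G) (semiBinary : SemiBinary N)
                     {k : ℕ} (P : Fin k → Shape G) (D : IsCherryDecomposition G (root N) k P) where

  open Degrees G
  open Network N semiBinary
  open Shapes G
  open ShapesInNetwork N semiBinary

  cherryᵢ retCherryᵢ : Fin k → ℕ
  cherryᵢ i    = 𝟙 (isCherry G (P i) ≟𝔹 true)
  retCherryᵢ i = 𝟙 (isRetCherry G (P i) ≟𝔹 true)

  cherries retCherries : ℕ
  cherries    = sum cherryᵢ
  retCherries = sum retCherryᵢ

  cover : ∀ f → ∑[ i < k ] occurrences (P i) f ≡ nonRootᵢ (btl G f)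
  cover f with btl G f ≟ root N
  ... | yes tail≡r = sum-zero _ (λ i → occurrences-absent (P i) f
                                  (λ f∈Pi → shape-tail-nonRoot (P i) (proj₁ D i) f f∈Pi tail≡r))
  ... | no tail≢r with proj₂ D f tail≢r
  ...   | i , f∈Pi , unique =
    trans (sum-single _ i (λ j j≢i → occurrences-absent (P j) f (λ f∈Pj → j≢i (unique j f∈Pj))))
          (occurrences-present (P i) (proj₁ D i) f f∈Pi)

  double-count : ∀ (w : BEdge G → ℕ) → ∑Σ (λ f → w f * nonRootᵢ (btl G f)) ≡ ∑[ i < k ] weight w (P i)
  double-count w = begin
    ∑Σ (λ f → w f * nonRootᵢ (btl G f))               ≡⟨ ∑Σ-cong (λ f → cong (w f *_) (cover f)) ⟨
    ∑Σ (λ f → w f * ∑[ i < k ] occurrences (P i) f)   ≡⟨ ∑Σ-cong (λ f → *-distribˡ-sum (w f) (λ i → occurrences (P i) f)) ⟩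
    ∑Σ (λ f → ∑[ i < k ] (w f * occurrences (P i) f)) ≡⟨ ∑Σ-comm (λ f i → w f * occurrences (P i) f) ⟩
    ∑[ i < k ] ∑Σ (λ f → w f * occurrences (P i) f)   ≡⟨ sum-cong-≗ (λ i → ∑-occurrences w (P i)) ⟩
    ∑[ i < k ] weight w (P i)                         ∎
    where open ≡-Reasoning

  nonRoot-edges : ∑[ v < V G ] (nonRootᵢ v * bulgedOut v) ≡ 2 * cherries + 3 * retCherries
  nonRoot-edges = begin
    ∑[ v < V G ] (nonRootᵢ v * bulgedOut v)          ≡⟨ ∑-by-tails nonRootᵢ ⟨
    ∑Σ (λ f → nonRootᵢ (btl G f))                    ≡⟨ ∑Σ-cong (λ f → *-identityˡ (nonRootᵢ (btl G f))) ⟨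
    ∑Σ (λ f → 1 * nonRootᵢ (btl G f))                ≡⟨ double-count (λ _ → 1) ⟩
    ∑[ i < k ] weight (λ _ → 1) (P i)                ≡⟨ sum-cong-≗ (λ i → weight-one (P i)) ⟩
    ∑[ i < k ] (2 * cherryᵢ i + 3 * retCherryᵢ i)    ≡⟨ ∑-distrib-+ (λ i → 2 * cherryᵢ i) (λ i → 3 * retCherryᵢ i) ⟩
    ∑[ i < k ] (2 * cherryᵢ i) + ∑[ i < k ] (3 * retCherryᵢ i)
                                                     ≡⟨ cong₂ _+_ (sum-*ˡ 2 cherryᵢ) (sum-*ˡ 3 retCherryᵢ) ⟩
    2 * cherries + 3 * retCherries                   ∎
    where open ≡-Reasoning

  reticulate-edges : ∑[ v < V G ] (retᵢ v * nonRootᵢ v * bulgedOut v) ≡ retCherries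
  reticulate-edges = begin
    ∑[ v < V G ] (retᵢ v * nonRootᵢ v * bulgedOut v)   ≡⟨ ∑-by-tails (λ v → retᵢ v * nonRootᵢ v) ⟨
    ∑Σ (λ f → retᵢ (btl G f) * nonRootᵢ (btl G f))     ≡⟨ double-count (retᵢ ∘ btl G) ⟩
    ∑[ i < k ] weight (retᵢ ∘ btl G) (P i)             ≡⟨ sum-cong-≗ (λ i → weight-ret (P i) (proj₁ D i)) ⟩
    retCherries                                        ∎
    where open ≡-Reasoning

  cherry-count : cherries ≡ n ∸ 1
  cherry-count = cancel-balance cherries retCherries Σin n (begin
    2 * cherries + 3 * retCherries + 2 * Σin + 2 * 1
      ≡⟨ cong₂ (λ β r → β + 2 * Σin + 2 * r) nonRoot-edges root-count ⟨
    ∑[ v < V G ] (nonRootᵢ v * bulgedOut v) + 2 * Σin + 2 * ∑[ v < V G ] rootᵢ v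
      ≡⟨ sum-combination (λ v → nonRootᵢ v * bulgedOut v) (indeg G) rootᵢ 2 2 ⟨
    ∑[ v < V G ] (nonRootᵢ v * bulgedOut v + 2 * indeg G v + 2 * rootᵢ v)
      ≡⟨ sum-cong-≗ vertex-balance ⟩
    ∑[ v < V G ] (2 * leafᵢ v + 3 * (retᵢ v * nonRootᵢ v * bulgedOut v) + 2 * outdeg G v)
      ≡⟨ sum-combination (λ v → 2 * leafᵢ v) (λ v → retᵢ v * nonRootᵢ v * bulgedOut v) (outdeg G) 3 2 ⟩
    ∑[ v < V G ] (2 * leafᵢ v) + 3 * ∑[ v < V G ] (retᵢ v * nonRootᵢ v * bulgedOut v) + 2 * Σout
      ≡⟨ cong₂ (λ l r → l + 3 * r + 2 * Σout) (trans (sum-*ˡ 2 leafᵢ) (cong (2 *_) leaf-count)) reticulate-edges ⟩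
    2 * n + 3 * retCherries + 2 * Σout
      ≡⟨ cong (λ d → 2 * n + 3 * retCherries + 2 * d) handshake ⟨
    2 * n + 3 * retCherries + 2 * Σin ∎)
    where
    open ≡-Reasoning
    Σin Σout : ℕ
    Σin  = ∑[ v < V G ] indeg G v
    Σout = ∑[ v < V G ] outdeg G v

  retCherry-count : retCherries ≡ retNumber G
  retCherry-count = begin
    retCherries                                   ≡⟨ m+n∸n≡m retCherries (∑[ v < V G ] retᵢ v) ⟨
    retCherries + ∑[ v < V G ] retᵢ v ∸ #rets     ≡⟨ cong (λ q → q + ∑[ v < V G ] retᵢ v ∸ #rets) reticulate-edges ⟨
    ∑[ v < V G ] (retᵢ v * nonRootᵢ v * bulgedOut v) + ∑[ v < V G ] retᵢ v ∸ #rets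
                                                  ≡⟨ cong (_∸ #rets) (∑-distrib-+ (λ v → retᵢ v * nonRootᵢ v * bulgedOut v) retᵢ) ⟨
    ∑[ v < V G ] (retᵢ v * nonRootᵢ v * bulgedOut v + retᵢ v) ∸ #rets
                                                  ≡⟨ cong (_∸ #rets) (sum-cong-≗ reticulation-balance) ⟩
    ∑[ v < V G ] (retᵢ v * indeg G v) ∸ #rets     ≡⟨ cong₂ _∸_ reticulate-edge-count reticulation-count ⟨
    retNumber G                                   ∎
    where
    open ≡-Reasoning
    #rets : ℕ
    #rets = ∑[ v < V G ] retᵢ v

mainTheorem4 : (n : ℕ) (G : DiGraph) (N : IsNetwork n G) → SemiBinary N →
               (k : ℕ) (P : Fin k → Shape G) →
               IsCherryDecomposition G (root N) k P →
               countShapes G (isCherry G) k P ≡ n ∸ 1 ×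
               countShapes G (isRetCherry G) k P ≡ retNumber G
mainTheorem4 n G N semiBinary k P D =
    trans (count-tabulate (λ i → isCherry G (P i) ≟𝔹 true) id) cherry-count
  , trans (count-tabulate (λ i → isRetCherry G (P i) ≟𝔹 true) id) retCherry-count
  where open Decomposition N semiBinary P D
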